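{- For every set $\Gamma$ of MSO formulas and every core-wMSO$(?,+)$ formula $\Phi$, there is a core-wMSO$(?,+)$ formula $\Phi'$ in normal form such that $\Gamma\vdash\Phi\approx\Phi'$ in the core-wMSO$(?,+)$ proof system.
   Context: MSO formulas $\varphi$ over a finite alphabet $\Sigma$ (syntax $\top, P_a(x), x\le y, x\in X,\neg,\wedge,\forall x,\forall X$); step-wMSO formulas over a weight set $R$: $\Psi::=r\mid\varphi\,?\,\Psi_1:\Psi_2$. core-wMSO$(?,+)$ formulas: $\Phi::=\mathbf{0}\mid\prod_x\Psi\mid\varphi\,?\,\Phi_1:\Phi_2\mid\Phi_1+\Phi_2$. Normal form: generated by $N::=\varphi\,?\,N_1:N_2\mid M\mid\mathbf{0}$, $M::=\prod_x\Psi\mid M_1+M_2$. $\Gamma\vdash\varphi$ refers to a fixed sound and complete proof system for MSO over finite nonempty words. The core-wMSO$(?,+)$ proof system derives $\Gamma\vdash\chi_1\approx\chi_2$ by: (ref), (sym), (trans); (cong?) $\Gamma\vdash\chi_1\approx\chi_1'$, $\Gamma\vdash\chi_2\approx\chi_2'$ imply $\Gamma\vdash\varphi\,?\,\chi_1:\chi_2\approx\varphi\,?\,\chi_1':\chi_2'$; (cong+) similarly for $+$; for step formulas (S1) $\Gamma\vdash\Psi_1\approx\Psi_2\Rightarrow\Gamma\cup\{\varphi\}\vdash\Psi_1\approx\Psi_2$, (S2) $\Gamma\vdash\neg\varphi\,?\,\Psi_1:\Psi_2\approx\varphi\,?\,\Psi_2:\Psi_1$, (S3) $\Gamma\vdash\varphi\Rightarrow\Gamma\vdash\varphi\,?\,\Psi_1:\Psi_2\approx\Psi_1$,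 (S4) $\Gamma\cup\{\varphi\}\vdash\Psi_1\approx\Psi$ and $\Gamma\cup\{\neg\varphi\}\vdash\Psi_2\approx\Psi\Rightarrow\Gamma\vdash\varphi\,?\,\Psi_1:\Psi_2\approx\Psi$; for core formulas (C1) $\Gamma\vdash\Phi+\mathbf{0}\approx\Phi$; (C2) commutativity of $+$; (C3) associativity of $+$; (C4) $\Gamma\vdash\Psi_1\approx\Psi_2$ with $x$ not free in $\Gamma$ implies $\Gamma\vdash\prod_x\Psi_1\approx\prod_x\Psi_2$; (C5) $\Gamma\vdash\prod_x\Psi\approx\prod_y\Psi[y/x]$ if $y$ does not occur in $\Psi$; (C6)–(C9) the analogues of (S1)–(S4) for core formulas; (C10) $\Gamma\vdash(\varphi\,?\,\Phi':\Phi'')+\Phi\approx\varphi\,?\,(\Phi'+\Phi):(\Phi''+\Phi)$. -}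

module Defs where

open import Data.Nat using (ℕ; zero; suc)
import Data.Nat as ℕ
open import Data.Fin using (Fin; zero; suc)
import Data.Fin as Fin
open import Data.Bool using (Bool; true; false; _∧_; not; T)
open import Data.List using (List; []; _∷_; concatMap; allFin)
open import Data.Sum using (_⊎_)
open import Relation.Nullary using (¬_; yes; no)
open import Relation.Nullary.Decidable using (⌊_⌋)
open import Relation.Binary.PropositionalEquality using (_≡_)

FOVar : Set
FOVar = ℕ

SOVar : Set
SOVar = ℕ

subsets : (m : ℕ) → List (Fin m → Bool)
subsets zero = (λ ()) ∷ []
subsets (suc m) =
  concatMap (λ f → (λ { zero → false ; (suc i) → f i })
                 ∷ (λ { zero → true ; (suc i) → f i }) ∷ []) (subsets m)

allL : {A : Set} → (A → Bool) → List A → Bool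
allL p []       = true
allL p (a ∷ as) = p a ∧ allL p as

update : {A : Set} → (ℕ → A) → ℕ → A → ℕ → A
update ν x a y with y ℕ.≟ x
... | yes _ = a
... | no _  = ν y

-- The finite alphabet is Σ = Fin k; R is an arbitrary weight set.
module WMSO (k : ℕ) (R : Set) where

  Σ : Set
  Σ = Fin k

  data MSO : Set where
    ⊤'   : MSO
    P    : Σ → FOVar → MSO
    _≤'_ : FOVar → FOVar → MSO
    _∈'_ : FOVar → SOVar → MSO
    ¬'_  : MSO → MSO
    _∧'_ : MSO → MSO → MSO
    ∀¹   : FOVar → MSO → MSO
    ∀²   : SOVar → MSO → MSO

  -- Semantics over finite nonempty words w : Fin (suc n) → Σ (positions
  -- Fin (suc n)), with assignments ν of positions to FO variables and μ of
  -- sets of positions to SO variables.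
  eval : (n : ℕ) → (w : Fin (suc n) → Σ) →
         (ν : FOVar → Fin (suc n)) → (μ : SOVar → Fin (suc n) → Bool) →
         MSO → Bool
  eval n w ν μ ⊤'         = true
  eval n w ν μ (P a x)    = ⌊ w (ν x) Fin.≟ a ⌋
  eval n w ν μ (x ≤' y)   = ⌊ ν x Fin.≤? ν y ⌋
  eval n w ν μ (x ∈' X)   = μ X (ν x)
  eval n w ν μ (¬' φ)     = not (eval n w ν μ φ)
  eval n w ν μ (φ ∧' ψ)   = eval n w ν μ φ ∧ eval n w ν μ ψ
  eval n w ν μ (∀¹ x φ)   = allL (λ i → eval n w (update ν x i) μ φ) (allFin (suc n))
  eval n w ν μ (∀² X φ)   = allL (λ S → eval n w ν (update μ X S) φ) (subsets (suc n))

  FSet : Set₁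
  FSet = MSO → Set

  _∪｛_｝ : FSet → MSO → FSet
  (Γ ∪｛ φ ｝) ψ = Γ ψ ⊎ ψ ≡ φ

  -- Γ ⊢ φ : the (fixed) sound and complete proof system for MSO over finite
  -- nonempty words. By soundness and completeness, derivability coincides
  -- with semantic consequence, which we use as its definition.
  _⊢_ : FSet → MSO → Set
  Γ ⊢ φ = (n : ℕ) (w : Fin (suc n) → Σ) (ν : FOVar → Fin (suc n))
          (μ : SOVar → Fin (suc n) → Bool) →
          ((ψ : MSO) → Γ ψ → T (eval n w ν μ ψ)) → T (eval n w ν μ φ)

  data FreeIn (x : FOVar) : MSO → Set where
    fP   : ∀ {a} → FreeIn x (P a x)
    f≤ˡ  : ∀ {y} → FreeIn x (x ≤' y)
    f≤ʳ  : ∀ {y} → FreeIn x (y ≤' x)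
    f∈   : ∀ {X} → FreeIn x (x ∈' X)
    f¬   : ∀ {φ} → FreeIn x φ → FreeIn x (¬' φ)
    f∧ˡ  : ∀ {φ ψ} → FreeIn x φ → FreeIn x (φ ∧' ψ)
    f∧ʳ  : ∀ {φ ψ} → FreeIn x ψ → FreeIn x (φ ∧' ψ)
    f∀¹  : ∀ {y φ} → ¬ (y ≡ x) → FreeIn x φ → FreeIn x (∀¹ y φ)
    f∀²  : ∀ {X φ} → FreeIn x φ → FreeIn x (∀² X φ)

  data OccursIn (x : FOVar) : MSO → Set where
    oP   : ∀ {a} → OccursIn x (P a x)
    o≤ˡ  : ∀ {y} → OccursIn x (x ≤' y)
    o≤ʳ  : ∀ {y} → OccursIn x (y ≤' x)
    o∈   : ∀ {X} → OccursIn x (x ∈' X)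
    o¬   : ∀ {φ} → OccursIn x φ → OccursIn x (¬' φ)
    o∧ˡ  : ∀ {φ ψ} → OccursIn x φ → OccursIn x (φ ∧' ψ)
    o∧ʳ  : ∀ {φ ψ} → OccursIn x ψ → OccursIn x (φ ∧' ψ)
    o∀b  : ∀ {φ} → OccursIn x (∀¹ x φ)
    o∀¹  : ∀ {y φ} → OccursIn x φ → OccursIn x (∀¹ y φ)
    o∀²  : ∀ {X φ} → OccursIn x φ → OccursIn x (∀² X φ)

  -- substitution φ[y/x] of the free occurrences of x by y
  rn : FOVar → FOVar → FOVar → FOVar
  rn y x z with z ℕ.≟ x
  ... | yes _ = y
  ... | no _  = z

  substF : MSO → FOVar → FOVar → MSO
  substF ⊤' y x        = ⊤'
  substF (P a z) y x   = P a (rn y x z)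
  substF (z ≤' z') y x = rn y x z ≤' rn y x z'
  substF (z ∈' X) y x  = rn y x z ∈' X
  substF (¬' φ) y x    = ¬' substF φ y x
  substF (φ ∧' ψ) y x  = substF φ y x ∧' substF ψ y x
  substF (∀¹ z φ) y x with z ℕ.≟ x
  ... | yes _ = ∀¹ z φ
  ... | no _  = ∀¹ z (substF φ y x)
  substF (∀² X φ) y x  = ∀² X (substF φ y x)

  data Step : Set where
    wt    : R → Step
    _⁇ˢ_∶_ : MSO → Step → Step → Step

  OccursInStep : FOVar → Step → Set
  OccursInStep x (wt r)        = Data.Empty.⊥
    where import Data.Empty
  OccursInStep x (φ ⁇ˢ Ψ₁ ∶ Ψ₂) = OccursIn x φ ⊎ (OccursInStep x Ψ₁ ⊎ OccursInStep x Ψ₂)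

  substS : Step → FOVar → FOVar → Step
  substS (wt r) y x        = wt r
  substS (φ ⁇ˢ Ψ₁ ∶ Ψ₂) y x = substF φ y x ⁇ˢ substS Ψ₁ y x ∶ substS Ψ₂ y x

  data Core : Set where
    𝟎      : Core
    ∏      : FOVar → Step → Core
    _⁇_∶_  : MSO → Core → Core → Core
    _⊕_    : Core → Core → Core

  data IsM : Core → Set where
    m∏ : ∀ {x Ψ} → IsM (∏ x Ψ)
    m+ : ∀ {M₁ M₂} → IsM M₁ → IsM M₂ → IsM (M₁ ⊕ M₂)

  data IsNF : Core → Set where
    n? : ∀ {φ N₁ N₂} → IsNF N₁ → IsNF N₂ → IsNF (φ ⁇ N₁ ∶ N₂)
    nM : ∀ {M} → IsM M → IsNF M
    n0 : IsNF 𝟎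

  data _⊢ˢ_≈_ : FSet → Step → Step → Set₁ where
    ref   : ∀ {Γ Ψ} → Γ ⊢ˢ Ψ ≈ Ψ
    sym   : ∀ {Γ Ψ₁ Ψ₂} → Γ ⊢ˢ Ψ₁ ≈ Ψ₂ → Γ ⊢ˢ Ψ₂ ≈ Ψ₁
    trans : ∀ {Γ Ψ₁ Ψ₂ Ψ₃} → Γ ⊢ˢ Ψ₁ ≈ Ψ₂ → Γ ⊢ˢ Ψ₂ ≈ Ψ₃ → Γ ⊢ˢ Ψ₁ ≈ Ψ₃
    cong? : ∀ {Γ φ Ψ₁ Ψ₁' Ψ₂ Ψ₂'} → Γ ⊢ˢ Ψ₁ ≈ Ψ₁' → Γ ⊢ˢ Ψ₂ ≈ Ψ₂' →
            Γ ⊢ˢ (φ ⁇ˢ Ψ₁ ∶ Ψ₂) ≈ (φ ⁇ˢ Ψ₁' ∶ Ψ₂')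
    S1    : ∀ {Γ φ Ψ₁ Ψ₂} → Γ ⊢ˢ Ψ₁ ≈ Ψ₂ → (Γ ∪｛ φ ｝) ⊢ˢ Ψ₁ ≈ Ψ₂
    S2    : ∀ {Γ φ Ψ₁ Ψ₂} → Γ ⊢ˢ ((¬' φ) ⁇ˢ Ψ₁ ∶ Ψ₂) ≈ (φ ⁇ˢ Ψ₂ ∶ Ψ₁)
    S3    : ∀ {Γ φ Ψ₁ Ψ₂} → Γ ⊢ φ → Γ ⊢ˢ (φ ⁇ˢ Ψ₁ ∶ Ψ₂) ≈ Ψ₁
    S4    : ∀ {Γ φ Ψ₁ Ψ₂ Ψ} → (Γ ∪｛ φ ｝) ⊢ˢ Ψ₁ ≈ Ψ → (Γ ∪｛ ¬' φ ｝) ⊢ˢ Ψ₂ ≈ Ψ →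
            Γ ⊢ˢ (φ ⁇ˢ Ψ₁ ∶ Ψ₂) ≈ Ψ

  data _⊢ᶜ_≈_ : FSet → Core → Core → Set₁ where
    ref   : ∀ {Γ Φ} → Γ ⊢ᶜ Φ ≈ Φ
    sym   : ∀ {Γ Φ₁ Φ₂} → Γ ⊢ᶜ Φ₁ ≈ Φ₂ → Γ ⊢ᶜ Φ₂ ≈ Φ₁
    trans : ∀ {Γ Φ₁ Φ₂ Φ₃} → Γ ⊢ᶜ Φ₁ ≈ Φ₂ → Γ ⊢ᶜ Φ₂ ≈ Φ₃ → Γ ⊢ᶜ Φ₁ ≈ Φ₃
    cong? : ∀ {Γ φ Φ₁ Φ₁' Φ₂ Φ₂'} → Γ ⊢ᶜ Φ₁ ≈ Φ₁' → Γ ⊢ᶜ Φ₂ ≈ Φ₂' →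
            Γ ⊢ᶜ (φ ⁇ Φ₁ ∶ Φ₂) ≈ (φ ⁇ Φ₁' ∶ Φ₂')
    cong+ : ∀ {Γ Φ₁ Φ₁' Φ₂ Φ₂'} → Γ ⊢ᶜ Φ₁ ≈ Φ₁' → Γ ⊢ᶜ Φ₂ ≈ Φ₂' →
            Γ ⊢ᶜ (Φ₁ ⊕ Φ₂) ≈ (Φ₁' ⊕ Φ₂')
    C1    : ∀ {Γ Φ} → Γ ⊢ᶜ (Φ ⊕ 𝟎) ≈ Φ
    C2    : ∀ {Γ Φ₁ Φ₂} → Γ ⊢ᶜ (Φ₁ ⊕ Φ₂) ≈ (Φ₂ ⊕ Φ₁)
    C3    : ∀ {Γ Φ₁ Φ₂ Φ₃} → Γ ⊢ᶜ ((Φ₁ ⊕ Φ₂) ⊕ Φ₃) ≈ (Φ₁ ⊕ (Φ₂ ⊕ Φ₃))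
    C4    : ∀ {Γ x Ψ₁ Ψ₂} → Γ ⊢ˢ Ψ₁ ≈ Ψ₂ → ((ψ : MSO) → Γ ψ → ¬ FreeIn x ψ) →
            Γ ⊢ᶜ ∏ x Ψ₁ ≈ ∏ x Ψ₂
    C5    : ∀ {Γ x y Ψ} → ¬ OccursInStep y Ψ → Γ ⊢ᶜ ∏ x Ψ ≈ ∏ y (substS Ψ y x)
    C6    : ∀ {Γ φ Φ₁ Φ₂} → Γ ⊢ᶜ Φ₁ ≈ Φ₂ → (Γ ∪｛ φ ｝) ⊢ᶜ Φ₁ ≈ Φ₂
    C7    : ∀ {Γ φ Φ₁ Φ₂} → Γ ⊢ᶜ ((¬' φ) ⁇ Φ₁ ∶ Φ₂) ≈ (φ ⁇ Φ₂ ∶ Φ₁)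
    C8    : ∀ {Γ φ Φ₁ Φ₂} → Γ ⊢ φ → Γ ⊢ᶜ (φ ⁇ Φ₁ ∶ Φ₂) ≈ Φ₁
    C9    : ∀ {Γ φ Φ₁ Φ₂ Φ} → (Γ ∪｛ φ ｝) ⊢ᶜ Φ₁ ≈ Φ → (Γ ∪｛ ¬' φ ｝) ⊢ᶜ Φ₂ ≈ Φ →
            Γ ⊢ᶜ (φ ⁇ Φ₁ ∶ Φ₂) ≈ Φ
    C10   : ∀ {Γ φ Φ' Φ'' Φ} →
            Γ ⊢ᶜ ((φ ⁇ Φ' ∶ Φ'') ⊕ Φ) ≈ (φ ⁇ (Φ' ⊕ Φ) ∶ (Φ'' ⊕ Φ))

module Submission where

open import Defs
open import Data.Nat using (ℕ)
open import Data.Product using (Σ-syntax; _×_; _,_)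

-- Axiom (C10), together with commutativity (C2), pushes a sum below a
-- conditional on either side, so the sum of two normal forms is normalised by
-- recursion on their conditional trees; every other construct is already normal
-- once its arguments are.

module Normalisation (k : ℕ) (R : Set) where
  open WMSO k R

  HasNF : FSet → Core → Set₁
  HasNF Γ Φ = Σ[ Φ' ∈ Core ] (IsNF Φ' × (Γ ⊢ᶜ Φ ≈ Φ'))

  module _ {Γ : FSet} where

    ⊕-identityˡ : ∀ {Φ} → Γ ⊢ᶜ (𝟎 ⊕ Φ) ≈ Φ
    ⊕-identityˡ = trans C2 C1

    ⊕-distribˡ-⁇ : ∀ {φ Φ Φ' Φ''} →
                   Γ ⊢ᶜ (Φ ⊕ (φ ⁇ Φ' ∶ Φ'')) ≈ (φ ⁇ (Φ ⊕ Φ') ∶ (Φ ⊕ Φ''))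
    ⊕-distribˡ-⁇ = trans C2 (trans C10 (cong? C2 C2))

    normalise-M⊕ : ∀ {M N} → IsM M → IsNF N → HasNF Γ (M ⊕ N)
    normalise-M⊕ m (n? n₁ n₂)
      with Φ₁ , nf₁ , eq₁ ← normalise-M⊕ m n₁
         | Φ₂ , nf₂ , eq₂ ← normalise-M⊕ m n₂
      = _ , n? nf₁ nf₂ , trans ⊕-distribˡ-⁇ (cong? eq₁ eq₂)
    normalise-M⊕ m (nM m') = _ , nM (m+ m m') , ref
    normalise-M⊕ m n0      = _ , nM m , C1

    normalise-⊕ : ∀ {N₁ N₂} → IsNF N₁ → IsNF N₂ → HasNF Γ (N₁ ⊕ N₂)
    normalise-⊕ (n? n₁ n₂) n
      with Φ₁ , nf₁ , eq₁ ← normalise-⊕ n₁ n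
         | Φ₂ , nf₂ , eq₂ ← normalise-⊕ n₂ n
      = _ , n? nf₁ nf₂ , trans C10 (cong? eq₁ eq₂)
    normalise-⊕ (nM m) n = normalise-M⊕ m n
    normalise-⊕ n0     n = _ , n , ⊕-identityˡ

    normalise : (Φ : Core) → HasNF Γ Φ
    normalise 𝟎       = 𝟎 , n0 , ref
    normalise (∏ x Ψ) = ∏ x Ψ , nM m∏ , ref
    normalise (φ ⁇ Φ₁ ∶ Φ₂)
      with Φ₁' , nf₁ , eq₁ ← normalise Φ₁
         | Φ₂' , nf₂ , eq₂ ← normalise Φ₂
      = φ ⁇ Φ₁' ∶ Φ₂' , n? nf₁ nf₂ , cong? eq₁ eq₂
    normalise (Φ₁ ⊕ Φ₂)
      with Φ₁' , nf₁ , eq₁ ← normalise Φ₁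
         | Φ₂' , nf₂ , eq₂ ← normalise Φ₂
      with Φ' , nf , eq ← normalise-⊕ nf₁ nf₂
      = Φ' , nf , trans (cong+ eq₁ eq₂) eq

lemma6 : (k : ℕ) (R : Set) → let open WMSO k R in
         (Γ : FSet) (Φ : Core) → Σ[ Φ' ∈ Core ] (IsNF Φ' × (Γ ⊢ᶜ Φ ≈ Φ'))
lemma6 k R Γ = Normalisation.normalise k R {Γ}
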